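{- Let $\mathbf{d}=(d_1,\dots,d_n)$ be a multigraphical sequence. Then $\mathbf{d}$ admits a realization which is a $C_4$-pivotable multigraph if and only if $\sum_{i=1}^n d_i=4(n-1)-4$ and $d_n\ge 2$.
   Context: A degree sequence is non-increasing, $d_1\ge\dots\ge d_n\ge 0$; it is multigraphical if some loopless multigraph on $v_1,\dots,v_n$ has $\deg(v_i)=d_i$ (a realization). A spanning tree of a multigraph is a set of edges (specific parallel copies) forming a tree on all vertices. A loopless multigraph $G$ on $n$ vertices with exactly $2n-4$ edges is a $C_4$-pivotable multigraph if $G$ contains an induced cycle $C$ of length 4 (the central cycle; induced meaning no chords, and additionally each edge of $C$ has multiplicity exactly one in $G$) and two spanning trees having exactly two common edges, both of which are edges of $C$. -}

module Defs where

open import Data.Nat as ℕ using (ℕ; zero; suc; _+_; _*_; _≥_)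
open import Data.Fin as Fin using (Fin; zero; suc; inject₁; fromℕ)
open import Data.Fin.Subset using (Subset; _∈_; _∩_; ∣_∣)
open import Data.Vec as Vec using (Vec; allFin; tabulate; count; sum)
open import Data.Product using (Σ; ∃; ∃-syntax; _×_; _,_; proj₁; proj₂)
open import Data.Sum using (_⊎_)
open import Data.Sum.Relation.Unary.All using ()
open import Relation.Nullary using (¬_; Dec)
open import Relation.Nullary.Decidable using (_⊎-dec_)
open import Relation.Binary.PropositionalEquality using (_≡_; _≢_)
open import Function.Definitions using (Injective)
open import Data.Fin.Properties using (_≟_)

-- Loopless multigraphs on the vertex set Fin n.
-- Edges are indexed by Fin m, so parallel copies are distinct edges.

record Multigraph (n : ℕ) : Set where
  field
    m         : ℕ
    ends      : Fin m → Fin n × Fin n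
    loopless  : ∀ e → proj₁ (ends e) ≢ proj₂ (ends e)

open Multigraph public

module _ {n : ℕ} (G : Multigraph n) where

  Incident : Fin n → Fin (m G) → Set
  Incident v e = proj₁ (ends G e) ≡ v ⊎ proj₂ (ends G e) ≡ v

  incident? : ∀ v e → Dec (Incident v e)
  incident? v e = (proj₁ (ends G e) ≟ v) ⊎-dec (proj₂ (ends G e) ≟ v)

  deg : Fin n → ℕ
  deg v = count (incident? v) (allFin (m G))

  Joins : Fin (m G) → Fin n → Fin n → Set
  Joins e u w = ends G e ≡ (u , w) ⊎ ends G e ≡ (w , u)

  joins? : ∀ e u w → Dec (Joins e u w)
  joins? e u w with ends G e
  ... | (a , b) = (((a ≟ u) ×d (b ≟ w))) ⊎-dec? ((a ≟ w) ×d (b ≟ u))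
    where
    open import Data.Product.Properties using (≡-dec)
    open import Relation.Nullary.Decidable using () renaming (_×-dec_ to _×d_)
    open import Relation.Nullary.Decidable using (map′)
    open import Relation.Binary.PropositionalEquality using (cong₂; refl)
    _⊎-dec?_ : _ → _ → Dec ((a , b) ≡ (u , w) ⊎ (a , b) ≡ (w , u))
    p ⊎-dec? q = map′ f₁ g₁ p ⊎-dec map′ f₁ g₁ q
      where
      f₁ : ∀ {x y : Fin n} → (a ≡ x × b ≡ y) → (a , b) ≡ (x , y)
      f₁ (refl , refl) = refl
      g₁ : ∀ {x y : Fin n} → (a , b) ≡ (x , y) → (a ≡ x × b ≡ y)
      g₁ refl = refl , refl

  mult : Fin n → Fin n → ℕ
  mult u w = count (λ e → joins? e u w) (allFin (m G))

  data Walk (T : Subset (m G)) : Fin n → Fin n → Set where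
    [] : ∀ {u} → Walk T u u
    _∷_ : ∀ {u w v} → (Σ (Fin (m G)) λ e → e ∈ T × Joins e u w)
          → Walk T w v → Walk T u v

  Connected : Subset (m G) → Set
  Connected T = ∀ u v → Walk T u v

  -- a cycle of length k ≥ 1 in T: vertices vs 0 … vs k with vs k = vs 0,
  -- vs 0 … vs (k-1) pairwise distinct, edges es 0 … es (k-1) pairwise
  -- distinct, all in T, es i joining vs i and vs (i+1).
  -- (Looplessness forces k ≥ 2; k = 2 is a pair of parallel edges.)
  record Cycle (T : Subset (m G)) : Set where
    field
      k        : ℕ
      nonempty : k ≥ 1
      vs       : Fin (suc k) → Fin n
      es       : Fin k → Fin (m G)
      closed   : vs (fromℕ k) ≡ vs zero
      vs-inj   : Injective _≡_ _≡_ (λ i → vs (inject₁ i))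
      es-inj   : Injective _≡_ _≡_ es
      es-in-T  : ∀ i → es i ∈ T
      es-join  : ∀ i → Joins (es i) (vs (inject₁ i)) (vs (suc i))

  Acyclic : Subset (m G) → Set
  Acyclic T = ¬ Cycle T

  SpanningTree : Subset (m G) → Set
  SpanningTree T = Connected T × Acyclic T

-- c : Fin 4 → Fin n lists the central cycle c0 c1 c2 c3 (in order).
module _ {n : ℕ} (G : Multigraph n) where

  c-next : Fin 4 → Fin 4
  c-next zero = suc zero
  c-next (suc zero) = suc (suc zero)
  c-next (suc (suc zero)) = suc (suc (suc zero))
  c-next (suc (suc (suc zero))) = zero

  InducedC4 : (Fin 4 → Fin n) → Set
  InducedC4 c = Injective _≡_ _≡_ c
              × (∀ i → mult G (c i) (c (c-next i)) ≡ 1)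
              × mult G (c zero) (c (suc (suc zero))) ≡ 0
              × mult G (c (suc zero)) (c (suc (suc (suc zero)))) ≡ 0

  OnCycle : (Fin 4 → Fin n) → Fin (m G) → Set
  OnCycle c e = Σ (Fin 4) λ i → Joins G e (c i) (c (c-next i))

  C4Pivotable : Set
  C4Pivotable =
    m G + 4 ≡ 2 * n
    × Σ (Fin 4 → Fin n) λ c → InducedC4 c
    × Σ (Subset (m G)) λ T₁ → Σ (Subset (m G)) λ T₂ →
        SpanningTree G T₁ × SpanningTree G T₂
        × ∣ T₁ ∩ T₂ ∣ ≡ 2
        × (∀ e → e ∈ T₁ ∩ T₂ → OnCycle c e)

Realizes : ∀ {n} → Multigraph n → (Fin n → ℕ) → Set
Realizes G d = ∀ v → deg G v ≡ d v

Multigraphical : ∀ {n} → (Fin n → ℕ) → Set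
Multigraphical {n} d = Σ (Multigraph n) λ G → Realizes G d

NonIncreasing : ∀ {n} → (Fin n → ℕ) → Set
NonIncreasing d = ∀ i j → i Fin.≤ j → d j ℕ.≤ d i

sumSeq : ∀ {n} → (Fin n → ℕ) → ℕ
sumSeq d = sum (tabulate d)

-- Necessity: the handshake lemma gives Σ d = 2 (2n − 4), and every vertex has degree ≥ 2:
-- each of the two spanning trees has an edge at it, and if they use the same edge, that edge
-- is shared, so it lies on the central cycle, whose vertices already have degree 2.
--
-- Sufficiency: put d = 2 + x with x non-increasing, Σ x = 2k, on k + 4 vertices. Take the
-- central cycle on the first four vertices and join every further vertex 4 + i to two
-- targets, one for each tree: the first tree is the cycle path 0–1–2–3 plus the first
-- targets' edges, the second the path 3–0–1–2 plus the second targets' edges. They share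
-- only the edges 01 and 12, and they are spanning trees as soon as every target lies below
-- its vertex in some ranking, because then every vertex other than 0 has exactly one
-- parent edge. Vertex w has degree 2 + (number of times w is a target), so w must be
-- chosen as a target x w times. List vertex 0 x₀ times, then vertex 1 x₁ times, and so on.
-- Since x is non-increasing with Σ x = 2k, the last excess is 0 or 1. If it is 0, vertex
-- 4 + i takes entries 2i and 2i + 1 of this list, and both come before 4 + i. If it is 1,
-- no such ordering reaches the last vertex. Instead, the second targets form the chain
-- 4 → 5 → ⋯ → k + 3 → 0, ranked in reverse, and the first targets take entries from the
-- list for x minus what the chain already supplies.

module Submission where

open import Defs
open import Data.Nat using (ℕ; zero; suc; _+_; _*_; _∸_; _≤_; _<_; _≥_; z≤n; s≤s; s≤s⁻¹; z<s; _<?_; _≤?_)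
open import Data.Nat.Properties hiding (_≟_; suc-injective)
open import Data.Fin as Fin using (Fin; zero; suc; toℕ; fromℕ; fromℕ<; inject₁; opposite; splitAt; _↑ˡ_; _↑ʳ_)
open import Data.Fin.Properties using (_≟_; ≤fromℕ; suc-injective; toℕ-injective; toℕ-inject₁; toℕ-fromℕ<; toℕ<n; opposite-prop; opposite-involutive; join-splitAt; splitAt-↑ˡ; splitAt-↑ʳ; ↑ˡ-injective)
open import Data.Fin.Subset using (Subset; _∈_; _∩_; ∣_∣)
open import Data.Fin.Subset.Properties using (x∈p∩q⁺; x∈p∩q⁻)
open import Data.Fin.Patterns using (0F; 1F; 2F; 3F)
open import Data.Vec.Properties using (lookup∘tabulate; []=⇒lookup; lookup⇒[]=)
open import Data.Vec as Vec using (tabulate; count)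
open import Data.Bool using (Bool; true; false; _∧_; if_then_else_)
open import Data.Product using (Σ; Σ-syntax; _×_; _,_; proj₁; proj₂)
open import Data.Sum using (_⊎_; inj₁; inj₂; [_,_]′)
open import Data.Empty using (⊥; ⊥-elim)
open import Relation.Nullary using (¬_; Dec; yes; no; does)
open import Relation.Binary.PropositionalEquality
open import Function.Base using (_∘_; id)
open import Data.Nat.Tactic.RingSolver using (solve-∀)
open import Function.Definitions using (Injective)
open import Function.Bundles using (_⇔_; mk⇔)
import Data.List.Base as List
open import Data.List.Extrema.Nat using (argmax; f[xs]≤f[argmax])
open import Data.List.Membership.Propositional.Properties using (∈-allFin)
import Data.List.Relation.Unary.All as All
open import Data.Fin.Relation.Unary.Top using (view; ‵fromℕ; ‵inject₁; view-fromℕ; view-inject₁)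
open import Algebra.Properties.CommutativeMonoid.Sum +-0-commutativeMonoid
  using (sum; sum-syntax; sum-cong-≗; ∑-distrib-+; ∑-comm; sum-init-last)

χ : ∀ {P : Set} → Dec P → ℕ
χ P? = if does P? then 1 else 0

χ-yes : ∀ {P : Set} (P? : Dec P) → P → χ P? ≡ 1
χ-yes (yes _) _ = refl
χ-yes (no ¬p) p = ⊥-elim (¬p p)

χ-no : ∀ {P : Set} (P? : Dec P) → ¬ P → χ P? ≡ 0
χ-no (yes p) ¬p = ⊥-elim (¬p p)
χ-no (no _)  _  = refl

χ-cong : ∀ {P Q : Set} (P? : Dec P) (Q? : Dec Q) → (P → Q) → (Q → P) → χ P? ≡ χ Q?
χ-cong (yes p) Q? f g = sym (χ-yes Q? (f p))
χ-cong (no ¬p) Q? f g = sym (χ-no Q? (¬p ∘ g))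

χ-positive : ∀ {P : Set} (P? : Dec P) → 1 ≤ χ P? → P
χ-positive (yes p) _ = p

count-tabulate : ∀ {A : Set} {P : A → Set} {k} (P? : ∀ x → Dec (P x)) (f : Fin k → A) →
                 count P? (tabulate f) ≡ ∑[ i < k ] χ (P? (f i))
count-tabulate {k = zero}  P? f = refl
count-tabulate {k = suc k} P? f with P? (f zero)
... | yes _ = cong suc (count-tabulate P? (f ∘ suc))
... | no _  = count-tabulate P? (f ∘ suc)

sum-tabulate : ∀ {k} (f : Fin k → ℕ) → Vec.sum (tabulate f) ≡ sum f
sum-tabulate {zero}  f = refl
sum-tabulate {suc k} f = cong (f zero +_) (sum-tabulate (f ∘ suc))

∑-const : ∀ k c → ∑[ i < k ] c ≡ k * c
∑-const zero    c = refl
∑-const (suc k) c = cong (c +_) (∑-const k c)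

∑-zero : ∀ {k} (f : Fin k → ℕ) → (∀ i → f i ≡ 0) → sum f ≡ 0
∑-zero {zero}  f f≡0 = refl
∑-zero {suc k} f f≡0 rewrite f≡0 zero = ∑-zero (f ∘ suc) (f≡0 ∘ suc)

∑-splitAt : ∀ a b (f : Fin (a + b) → ℕ) → sum f ≡ ∑[ i < a ] f (i ↑ˡ b) + ∑[ j < b ] f (a ↑ʳ j)
∑-splitAt zero    b f = refl
∑-splitAt (suc a) b f = trans (cong (f zero +_) (∑-splitAt a b (f ∘ suc))) (sym (+-assoc (f zero) _ _))

∑-χ-≟ : ∀ {k} (w : Fin k) → ∑[ i < k ] χ (i ≟ w) ≡ 1
∑-χ-≟ {suc k} zero = cong suc (∑-zero {k} _ (λ i → χ-no (suc i ≟ zero) λ ()))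
∑-χ-≟ {suc k} (suc w) = trans (sum-cong-≗ (λ i → χ-cong (suc i ≟ suc w) (i ≟ w) suc-injective (cong suc))) (∑-χ-≟ w)

∑-mono-≤ : ∀ {k} {f g : Fin k → ℕ} → (∀ i → f i ≤ g i) → sum f ≤ sum g
∑-mono-≤ {zero}  _   = z≤n
∑-mono-≤ {suc k} f≤g = +-mono-≤ (f≤g zero) (∑-mono-≤ (f≤g ∘ suc))

term≤∑ : ∀ {k} (f : Fin k → ℕ) i → f i ≤ sum f
term≤∑ f zero    = m≤m+n _ _
term≤∑ f (suc i) = ≤-trans (term≤∑ (f ∘ suc) i) (m≤n+m _ (f zero))

two-terms≤∑ : ∀ {k} (f : Fin k → ℕ) {i j} → i ≢ j → f i + f j ≤ sum f
two-terms≤∑ f {zero}  {zero}  i≢j = ⊥-elim (i≢j refl)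
two-terms≤∑ f {zero}  {suc j} _   = +-monoʳ-≤ (f zero) (term≤∑ (f ∘ suc) j)
two-terms≤∑ f {suc i} {zero}  _   = subst (_≤ sum f) (+-comm (f zero) _) (+-monoʳ-≤ (f zero) (term≤∑ (f ∘ suc) i))
two-terms≤∑ f {suc i} {suc j} i≢j = ≤-trans (two-terms≤∑ (f ∘ suc) (i≢j ∘ cong suc)) (m≤n+m _ (f zero))

∑-positive : ∀ {k} (f : Fin k → ℕ) → 1 ≤ sum f → Σ[ i ∈ Fin k ] 1 ≤ f i
∑-positive {suc k} f 1≤∑ with f zero in eq
... | suc _ = zero , subst (1 ≤_) (sym eq) (s≤s z≤n)
... | zero  = let i , 1≤fi = ∑-positive (f ∘ suc) 1≤∑ in suc i , 1≤fi

∈-tabulate⁻ : ∀ {k} (f : Fin k → Bool) {e} → e ∈ tabulate f → f e ≡ true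
∈-tabulate⁻ f {e} e∈ = trans (sym (lookup∘tabulate f e)) ([]=⇒lookup e∈)

∈-tabulate⁺ : ∀ {k} (f : Fin k → Bool) {e} → f e ≡ true → e ∈ tabulate f
∈-tabulate⁺ f {e} fe≡true = lookup⇒[]= e (tabulate f) (trans (lookup∘tabulate f e) fe≡true)

∣tabulate∩tabulate∣≡0 : ∀ {k} (f g : Fin k → Bool) → (∀ i → f i ∧ g i ≡ false) → ∣ tabulate f ∩ tabulate g ∣ ≡ 0
∣tabulate∩tabulate∣≡0 {zero}  f g disjoint = refl
∣tabulate∩tabulate∣≡0 {suc k} f g disjoint rewrite disjoint zero = ∣tabulate∩tabulate∣≡0 (f ∘ suc) (g ∘ suc) (disjoint ∘ suc)

fibreSize : ∀ {k n} → (Fin k → Fin n) → Fin n → ℕ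
fibreSize {k} f w = ∑[ i < k ] χ (f i ≟ w)

partialSum : (ℕ → ℕ) → ℕ → ℕ
partialSum f b = ∑[ i < b ] f (toℕ i)

partialSum-+ : ∀ f a b → partialSum f (a + b) ≡ partialSum f a + partialSum (λ j → f (a + j)) b
partialSum-+ f zero    b = refl
partialSum-+ f (suc a) b = trans (cong (f 0 +_) (partialSum-+ (f ∘ suc) a b)) (sym (+-assoc (f 0) _ _))

partialSum-suc : ∀ f b → partialSum f (suc b) ≡ partialSum f b + f b
partialSum-suc f zero    = +-comm (f 0) 0
partialSum-suc f (suc b) = trans (cong (f 0 +_) (partialSum-suc (f ∘ suc) b)) (sym (+-assoc (f 0) _ _))

partialSum-cong : ∀ {f g} b → (∀ j → j < b → f j ≡ g j) → partialSum f b ≡ partialSum g b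
partialSum-cong b f≡g = sum-cong-≗ (λ i → f≡g (toℕ i) (toℕ<n i))

partialSum-lower : ∀ {f} c b → (∀ j → j < b → c ≤ f j) → b * c ≤ partialSum f b
partialSum-lower c b c≤f = subst (_≤ _) (∑-const b c) (∑-mono-≤ (λ i → c≤f (toℕ i) (toℕ<n i)))

partialSum-upper : ∀ {f} c b → (∀ j → j < b → f j ≤ c) → partialSum f b ≤ b * c
partialSum-upper c b f≤c = subst (_ ≤_) (∑-const b c) (∑-mono-≤ (λ i → f≤c (toℕ i) (toℕ<n i)))

partialSum-pairs : ∀ f k → partialSum (λ i → f (2 * i) + f (suc (2 * i))) k ≡ partialSum f (2 * k)
partialSum-pairs f zero    = refl
partialSum-pairs f (suc k) = begin
  f 0 + f 1 + partialSum (λ i → f (2 * suc i) + f (suc (2 * suc i))) k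
    ≡⟨ cong (f 0 + f 1 +_) (partialSum-cong k (λ i _ → cong (λ t → f t + f (suc t)) (*-suc 2 i))) ⟩
  f 0 + f 1 + partialSum (λ i → f (2 + 2 * i) + f (3 + 2 * i)) k
    ≡⟨ cong (f 0 + f 1 +_) (partialSum-pairs (λ j → f (2 + j)) k) ⟩
  f 0 + f 1 + partialSum (λ j → f (2 + j)) (2 * k)
    ≡⟨ +-assoc (f 0) (f 1) _ ⟩
  partialSum f (2 + 2 * k)
    ≡⟨ cong (partialSum f) (sym (*-suc 2 k)) ⟩
  partialSum f (2 * suc k) ∎
  where open ≡-Reasoning

-- Entry j of the list with a 0 copies of vertex 0, then a 1 copies of vertex 1, and so on.
-- Entries past the end all go to the last vertex.
slot : ∀ N → (ℕ → ℕ) → ℕ → Fin (suc N)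
slot zero    a j = zero
slot (suc N) a j with j <? a 0
... | yes _ = zero
... | no _  = suc (slot N (a ∘ suc) (j ∸ a 0))

slot-head : ∀ N a {j} → j < a 0 → slot N a j ≡ zero
slot-head zero    a _ = refl
slot-head (suc N) a {j} j<a₀ with j <? a 0
... | yes _    = refl
... | no j≮a₀ = ⊥-elim (j≮a₀ j<a₀)

slot-tail : ∀ N a j → slot (suc N) a (a 0 + j) ≡ suc (slot N (a ∘ suc) j)
slot-tail N a j with a 0 + j <? a 0
... | yes a₀+j<a₀ = ⊥-elim (m+n≮m (a 0) j a₀+j<a₀)
... | no _        = cong (suc ∘ slot N (a ∘ suc)) (m+n∸m≡n (a 0) j)

slot-fibre : ∀ N a (w : Fin (suc N)) → partialSum (λ j → χ (slot N a j ≟ w)) (partialSum a (suc N)) ≡ a (toℕ w)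
slot-fibre zero    a zero = trans (∑-const (a 0 + 0) 1) (trans (*-identityʳ _) (+-identityʳ _))
slot-fibre (suc N) a w    = begin
  partialSum fibre (a 0 + rest)
    ≡⟨ partialSum-+ fibre (a 0) rest ⟩
  partialSum fibre (a 0) + partialSum (λ j → fibre (a 0 + j)) rest
    ≡⟨ cong₂ _+_ (partialSum-cong (a 0) (λ j j<a₀ → cong (λ v → χ (v ≟ w)) (slot-head (suc N) a j<a₀)))
                 (partialSum-cong rest (λ j _ → cong (λ v → χ (v ≟ w)) (slot-tail N a j))) ⟩
  partialSum (λ _ → χ (zero ≟ w)) (a 0) + partialSum (λ j → χ (suc (slot N (a ∘ suc) j) ≟ w)) rest
    ≡⟨ cong (_+ partialSum (λ j → χ (suc (slot N (a ∘ suc) j) ≟ w)) rest) (∑-const (a 0) _) ⟩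
  a 0 * χ (zero ≟ w) + partialSum (λ j → χ (suc (slot N (a ∘ suc) j) ≟ w)) rest
    ≡⟨ by-target w ⟩
  a (toℕ w) ∎
  where
  open ≡-Reasoning
  fibre = λ j → χ (slot (suc N) a j ≟ w)
  rest = partialSum (a ∘ suc) (suc N)
  by-target : ∀ w → a 0 * χ (zero ≟ w) + partialSum (λ j → χ (suc (slot N (a ∘ suc) j) ≟ w)) rest ≡ a (toℕ w)
  by-target zero    = trans (cong₂ _+_ (*-identityʳ (a 0)) (∑-zero {rest} _ (λ _ → refl))) (+-identityʳ (a 0))
  by-target (suc w) = trans (cong (_+ partialSum (λ j → χ (slot N (a ∘ suc) j ≟ w)) rest) (*-zeroʳ (a 0)))
                             (slot-fibre N (a ∘ suc) w)

slot-bound : ∀ N a p {j} → j < partialSum a p → toℕ (slot N a j) < p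
slot-bound zero    a (suc p)     _   = s≤s z≤n
slot-bound (suc N) a (suc p) {j} j<P with j <? a 0
... | yes _    = s≤s z≤n
... | no j≮a₀ = s≤s (slot-bound N (a ∘ suc) p
                       (+-cancelˡ-< (a 0) _ _ (subst (_< a 0 + partialSum (a ∘ suc) p) (sym (m+[n∸m]≡n (≮⇒≥ j≮a₀))) j<P)))

extend : ∀ {N} → (Fin N → ℕ) → ℕ → ℕ
extend {zero}  f _       = 0
extend {suc N} f zero    = f zero
extend {suc N} f (suc j) = extend (f ∘ suc) j

extend-toℕ : ∀ {N} (f : Fin N → ℕ) i → extend f (toℕ i) ≡ f i
extend-toℕ f zero    = refl
extend-toℕ f (suc i) = extend-toℕ (f ∘ suc) i

sum≡partialSum-extend : ∀ {N} (f : Fin N → ℕ) → sum f ≡ partialSum (extend f) N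
sum≡partialSum-extend f = sum-cong-≗ (sym ∘ extend-toℕ f)

last≤ : ∀ {n} {d : Fin (suc n) → ℕ} → NonIncreasing d → ∀ w → d (fromℕ n) ≤ d w
last≤ d-noninc w = d-noninc w (fromℕ _) (≤fromℕ w)

AntitoneBelow : ℕ → (ℕ → ℕ) → Set
AntitoneBelow N x = ∀ {j j′} → j ≤ j′ → j′ < N → x j′ ≤ x j

extend-antitone : ∀ {N} (f : Fin N → ℕ) → NonIncreasing f → AntitoneBelow N (extend f)
extend-antitone f f-noninc {j} {j′} j≤j′ j′<N = begin
  extend f j′                       ≡⟨ cong (extend f) (toℕ-fromℕ< j′<N) ⟨
  extend f (toℕ (fromℕ< j′<N))      ≡⟨ extend-toℕ f _ ⟩
  f (fromℕ< j′<N)                   ≤⟨ f-noninc _ _ (subst₂ _≤_ (sym (toℕ-fromℕ< j<N)) (sym (toℕ-fromℕ< j′<N)) j≤j′) ⟩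
  f (fromℕ< j<N)                    ≡⟨ extend-toℕ f _ ⟨
  extend f (toℕ (fromℕ< j<N))       ≡⟨ cong (extend f) (toℕ-fromℕ< j<N) ⟩
  extend f j                        ∎
  where
  open ≤-Reasoning
  j<N = ≤-<-trans j≤j′ j′<N

partialSum-tail-bound : ∀ {x c} p q → AntitoneBelow (p + suc q) x → x p ≤ c →
                        partialSum x (p + suc q) ≤ partialSum x p + (q * c + x (p + q))
partialSum-tail-bound {x} {c} p q antitone xp≤c = begin
  partialSum x (p + suc q)                                          ≡⟨ partialSum-+ x p (suc q) ⟩
  partialSum x p + partialSum (λ j → x (p + j)) (suc q)             ≡⟨ cong (partialSum x p +_) (partialSum-suc (λ j → x (p + j)) q) ⟩
  partialSum x p + (partialSum (λ j → x (p + j)) q + x (p + q))     ≤⟨ +-monoʳ-≤ (partialSum x p) (+-monoˡ-≤ (x (p + q)) middle) ⟩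
  partialSum x p + (q * c + x (p + q))                              ∎
  where
  open ≤-Reasoning
  middle : partialSum (λ j → x (p + j)) q ≤ q * c
  middle = partialSum-upper c q (λ j j<q → ≤-trans (antitone (m≤m+n p j) (+-monoʳ-< p (m<n⇒m<1+n j<q))) xp≤c)

maximum-attained : ∀ {k} (f : Fin (suc k) → ℕ) → Σ[ i ∈ Fin (suc k) ] (∀ j → f j ≤ f i)
maximum-attained {k} f = i , λ j → All.lookup (f[xs]≤f[argmax] {f = f} zero (List.allFin (suc k))) (∈-allFin j)
  where i = argmax f zero (List.allFin (suc k))

closed-bound : ∀ {k b} (f : Fin (suc (suc k)) → ℕ) → f (fromℕ (suc k)) ≡ f zero →
               (∀ i → f (inject₁ i) ≤ b) → ∀ j → f j ≤ b
closed-bound f closed f≤b j with view j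
... | ‵fromℕ     = subst (_≤ _) (sym closed) (f≤b zero)
... | ‵inject₁ i = f≤b i

cyclicPred : ∀ {k} → Fin (suc (suc k)) → Fin (suc (suc k))
cyclicPred zero    = fromℕ _
cyclicPred (suc i) = inject₁ i

cyclicPred-≢ : ∀ {k} (i : Fin (suc (suc k))) → i ≢ cyclicPred i
cyclicPred-≢ zero    ()
cyclicPred-≢ (suc i) i≡ = 1+n≢n (trans (cong toℕ i≡) (toℕ-inject₁ i))

other-than : ∀ {n} {a b : Fin n} → a ≢ b → ∀ v → Σ[ u ∈ Fin n ] v ≢ u
other-than {a = a} {b} a≢b v with a ≟ v
... | yes refl = b , a≢b
... | no a≢v   = a , a≢v ∘ sym

module _ {n : ℕ} (G : Multigraph n) where

  Joins-sym : ∀ {e u w} → Joins G e u w → Joins G e w u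
  Joins-sym (inj₁ p) = inj₂ p
  Joins-sym (inj₂ p) = inj₁ p

  Joins-irrefl : ∀ {e u w} → Joins G e u w → u ≢ w
  Joins-irrefl {e} (inj₁ p) refl = loopless G e (trans (cong proj₁ p) (sym (cong proj₂ p)))
  Joins-irrefl {e} (inj₂ p) refl = loopless G e (trans (cong proj₁ p) (sym (cong proj₂ p)))

  Joins⇒Incident : ∀ {e u w} → Joins G e u w → Incident G u e
  Joins⇒Incident (inj₁ p) = inj₁ (cong proj₁ p)
  Joins⇒Incident (inj₂ p) = inj₂ (cong proj₂ p)

  Joins-ends : ∀ {e a b a′ b′} → Joins G e a b → Joins G e a′ b′ → (a ≡ a′ × b ≡ b′) ⊎ (a ≡ b′ × b ≡ a′)
  Joins-ends (inj₁ p) (inj₁ q) with trans (sym p) q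
  ... | refl = inj₁ (refl , refl)
  Joins-ends (inj₁ p) (inj₂ q) with trans (sym p) q
  ... | refl = inj₂ (refl , refl)
  Joins-ends (inj₂ p) (inj₁ q) with trans (sym p) q
  ... | refl = inj₂ (refl , refl)
  Joins-ends (inj₂ p) (inj₂ q) with trans (sym p) q
  ... | refl = inj₁ (refl , refl)

  Incident-Joins : ∀ {e a b v} → Joins G e a b → Incident G v e → v ≡ a ⊎ v ≡ b
  Incident-Joins (inj₁ p) (inj₁ q) = inj₁ (trans (sym q) (cong proj₁ p))
  Incident-Joins (inj₁ p) (inj₂ q) = inj₂ (trans (sym q) (cong proj₂ p))
  Incident-Joins (inj₂ p) (inj₁ q) = inj₂ (trans (sym q) (cong proj₁ p))
  Incident-Joins (inj₂ p) (inj₂ q) = inj₁ (trans (sym q) (cong proj₂ p))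

  module _ {T : Subset (m G)} where

    _++ʷ_ : ∀ {u v w} → Walk G T u v → Walk G T v w → Walk G T u w
    []      ++ʷ q = q
    (s ∷ p) ++ʷ q = s ∷ (p ++ʷ q)

    reverseʷ : ∀ {u v} → Walk G T u v → Walk G T v u
    reverseʷ []                  = []
    reverseʷ ((e , e∈T , j) ∷ p) = reverseʷ p ++ʷ ((e , e∈T , Joins-sym j) ∷ [])

    firstEdge : ∀ {u v} → u ≢ v → Walk G T u v → Σ[ e ∈ Fin (m G) ] e ∈ T × Incident G u e
    firstEdge u≢v []                  = ⊥-elim (u≢v refl)
    firstEdge _   ((e , e∈T , j) ∷ _) = e , e∈T , Joins⇒Incident j

  deg-endpoints : ∀ v → deg G v ≡ ∑[ e < m G ] (χ (proj₁ (ends G e) ≟ v) + χ (proj₂ (ends G e) ≟ v))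
  deg-endpoints v = trans (count-tabulate (incident? G v) id) (sum-cong-≗ split)
    where
    split : ∀ e → χ (incident? G v e) ≡ χ (proj₁ (ends G e) ≟ v) + χ (proj₂ (ends G e) ≟ v)
    split e with proj₁ (ends G e) ≟ v | proj₂ (ends G e) ≟ v
    ... | yes p | yes q = ⊥-elim (loopless G e (trans p (sym q)))
    ... | yes _ | no _  = refl
    ... | no _  | yes _ = refl
    ... | no _  | no _  = refl

  handshake : ∑[ v < n ] deg G v ≡ m G * 2
  handshake = begin
    ∑[ v < n ] deg G v                                                     ≡⟨ sum-cong-≗ deg-endpoints ⟩
    ∑[ v < n ] ∑[ e < m G ] (χ (proj₁ (ends G e) ≟ v) + χ (proj₂ (ends G e) ≟ v)) ≡⟨ ∑-comm {n} {m G} _ ⟩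
    ∑[ e < m G ] ∑[ v < n ] (χ (proj₁ (ends G e) ≟ v) + χ (proj₂ (ends G e) ≟ v)) ≡⟨ sum-cong-≗ twice ⟩
    ∑[ e < m G ] 2                                                          ≡⟨ ∑-const (m G) 2 ⟩
    m G * 2                                                                 ∎
    where
    open ≡-Reasoning
    once : ∀ a → ∑[ v < n ] χ (a ≟ v) ≡ 1
    once a = trans (sum-cong-≗ (λ v → χ-cong (a ≟ v) (v ≟ a) sym sym)) (∑-χ-≟ a)
    twice : ∀ e → ∑[ v < n ] (χ (proj₁ (ends G e) ≟ v) + χ (proj₂ (ends G e) ≟ v)) ≡ 2
    twice e = trans (∑-distrib-+ {n} _ _) (cong₂ _+_ (once (proj₁ (ends G e))) (once (proj₂ (ends G e))))

  two-incident⇒deg≥2 : ∀ {v e e′} → e ≢ e′ → Incident G v e → Incident G v e′ → 2 ≤ deg G v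
  two-incident⇒deg≥2 {v} {e} {e′} e≢e′ v∈e v∈e′ = begin
    2                                                       ≡⟨ cong₂ _+_ (χ-yes (incident? G v e) v∈e) (χ-yes (incident? G v e′) v∈e′) ⟨
    χ (incident? G v e) + χ (incident? G v e′)              ≤⟨ two-terms≤∑ (λ e → χ (incident? G v e)) e≢e′ ⟩
    ∑[ e < m G ] χ (incident? G v e)                        ≡⟨ count-tabulate (incident? G v) id ⟨
    deg G v                                                 ∎
    where open ≤-Reasoning

  mult-positive : ∀ {u w} → 1 ≤ mult G u w → Σ[ e ∈ Fin (m G) ] Joins G e u w
  mult-positive {u} {w} 1≤mult =
    let e , 1≤χ = ∑-positive _ (≤-trans 1≤mult (≤-reflexive (count-tabulate (λ e → joins? G e u w) id)))
    in e , χ-positive (joins? G e u w) 1≤χ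

  c-prev : Fin 4 → Fin 4
  c-prev 0F = 3F
  c-prev 1F = 0F
  c-prev 2F = 1F
  c-prev 3F = 2F

  InducedC4⇒deg≥2 : ∀ {c} → InducedC4 G c → ∀ j → 2 ≤ deg G (c j)
  InducedC4⇒deg≥2 {c} (c-injective , mult≡1 , _) j =
    two-incident⇒deg≥2 e≢e′ (Joins⇒Incident e-joins) (Joins⇒Incident (Joins-sym e′-joins))
    where
    edge : ∀ i → Σ[ e ∈ Fin (m G) ] Joins G e (c i) (c (c-next G i))
    edge i = mult-positive (≤-reflexive (sym (mult≡1 i)))
    e = proj₁ (edge j)
    e-joins = proj₂ (edge j)
    e′ = proj₁ (edge (c-prev j))
    e′-joins : Joins G e′ (c (c-prev j)) (c j)
    e′-joins = subst (λ i → Joins G e′ (c (c-prev j)) (c i)) (next-prev j) (proj₂ (edge (c-prev j)))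
      where
      next-prev : ∀ j → c-next G (c-prev j) ≡ j
      next-prev 0F = refl
      next-prev 1F = refl
      next-prev 2F = refl
      next-prev 3F = refl
    e≢e′ : e ≢ e′
    e≢e′ e≡e′ with Joins-ends e-joins (subst (λ x → Joins G x (c (c-prev j)) (c j)) (sym e≡e′) e′-joins)
    ... | inj₁ (same , _) = prev≢ j (c-injective same)
      where
      prev≢ : ∀ j → j ≢ c-prev j
      prev≢ 0F ()
      prev≢ 1F ()
      prev≢ 2F ()
      prev≢ 3F ()
    ... | inj₂ (_ , same) = next≢prev j (c-injective same)
      where
      next≢prev : ∀ j → c-next G j ≢ c-prev j
      next≢prev 0F ()
      next≢prev 1F ()
      next≢prev 2F ()
      next≢prev 3F ()

  record ParentEdges (T : Subset (m G)) : Set where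
    field
      rank           : Fin n → ℕ
      rank-injective : Injective _≡_ _≡_ rank
      root           : Fin n
      parent         : Fin n → Fin (m G)
      up             : Fin n → Fin n
      parent∈T       : ∀ v → v ≢ root → parent v ∈ T
      parent-joins   : ∀ v → v ≢ root → Joins G (parent v) v (up v)
      up-lower       : ∀ v → v ≢ root → rank (up v) < rank v
      T⊆parents      : ∀ e → e ∈ T → Σ[ v ∈ Fin n ] v ≢ root × parent v ≡ e

  module _ {T : Subset (m G)} (P : ParentEdges T) where
    open ParentEdges P

    walkToRoot : ∀ b v → rank v < b → Walk G T v root
    walkToRoot (suc b) v v<b with v ≟ root
    ... | yes refl = []
    ... | no v≢root = (parent v , parent∈T v v≢root , parent-joins v v≢root)
                    ∷ walkToRoot b (up v) (≤-trans (up-lower v v≢root) (s≤s⁻¹ v<b))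

    ParentEdges⇒Connected : Connected G T
    ParentEdges⇒Connected u v = walkToRoot _ u ≤-refl ++ʷ reverseʷ (walkToRoot _ v ≤-refl)

    descending⇒parent : ∀ {e x y} → e ∈ T → Joins G e x y → rank y < rank x → e ≡ parent x
    descending⇒parent {e} e∈T e-joins y<x with T⊆parents e e∈T
    ... | v , v≢root , refl with Joins-ends e-joins (parent-joins v v≢root)
    ...   | inj₁ (refl , _)    = refl
    ...   | inj₂ (refl , refl) = ⊥-elim (<-asym y<x (up-lower v v≢root))

    -- The trail edges entering and leaving a vertex of maximal rank both go down from it,
    -- so both are its parent edge.
    no-closed-trail : ∀ k (vs : Fin (suc (suc k)) → Fin n) (es : Fin (suc k) → Fin (m G)) →
                   vs (fromℕ (suc k)) ≡ vs zero → Injective _≡_ _≡_ es → (∀ i → es i ∈ T) →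
                   (∀ i → Joins G (es i) (vs (inject₁ i)) (vs (suc i))) → ⊥
    no-closed-trail zero    vs es closed _ _ es-join = Joins-irrefl (es-join zero) (sym closed)
    no-closed-trail (suc k) vs es closed es-inj es∈T es-join =
      cyclicPred-≢ i* (es-inj (trans (descending⇒parent (es∈T i*) (es-join i*) (lower (es-join i*)))
                                     (sym (descending⇒parent (es∈T p) p-joins (lower p-joins)))))
      where
      i* : Fin (suc (suc k))
      i* = proj₁ (maximum-attained (λ i → rank (vs (inject₁ i))))
      x : Fin n
      x = vs (inject₁ i*)

      maximal : ∀ j → rank (vs j) ≤ rank x
      maximal = closed-bound (rank ∘ vs) (cong rank closed) (proj₂ (maximum-attained (λ i → rank (vs (inject₁ i)))))

      lower : ∀ {e j} → Joins G e x (vs j) → rank (vs j) < rank x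
      lower {j = j} e-joins = ≤∧≢⇒< (maximal j) (λ eq → Joins-irrefl e-joins (sym (rank-injective eq)))

      p : Fin (suc (suc k))
      p = cyclicPred i*
      p-joins : Joins G (es p) x (vs (inject₁ p))
      p-joins = Joins-sym (subst (Joins G (es p) (vs (inject₁ p))) (enters i*) (es-join p))
        where
        enters : ∀ i → vs (suc (cyclicPred i)) ≡ vs (inject₁ i)
        enters zero    = closed
        enters (suc i) = refl

    ParentEdges⇒Acyclic : Acyclic G T
    ParentEdges⇒Acyclic record { k = suc k ; vs = vs ; es = es ; closed = closed
                               ; es-inj = es-inj ; es-in-T = es∈T ; es-join = es-join } =
      no-closed-trail k vs es closed es-inj es∈T es-join

    ParentEdges⇒SpanningTree : SpanningTree G T
    ParentEdges⇒SpanningTree = ParentEdges⇒Connected , ParentEdges⇒Acyclic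

  C4Pivotable⇒deg≥2 : C4Pivotable G → ∀ v → 2 ≤ deg G v
  C4Pivotable⇒deg≥2 (_ , c , induced , T₁ , T₂ , (conn₁ , _) , (conn₂ , _) , _ , shared⇒cycle) v
    with other-than ((λ ()) ∘ proj₁ induced {1F} {0F}) v
  ... | u , v≢u with firstEdge v≢u (conn₁ v u) | firstEdge v≢u (conn₂ v u)
  ...   | e₁ , e₁∈T₁ , v∈e₁ | e₂ , e₂∈T₂ , v∈e₂ with e₁ ≟ e₂
  ...     | no e₁≢e₂ = two-incident⇒deg≥2 e₁≢e₂ v∈e₁ v∈e₂
  ...     | yes refl with shared⇒cycle e₁ (x∈p∩q⁺ (e₁∈T₁ , e₂∈T₂))
  ...       | i , e₁-joins with Incident-Joins e₁-joins v∈e₁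
  ...         | inj₁ refl = InducedC4⇒deg≥2 induced i
  ...         | inj₂ refl = InducedC4⇒deg≥2 induced (c-next G i)

-- Necessity

necessity : ∀ n (d : Fin (suc n) → ℕ) (G : Multigraph (suc n)) → Realizes G d → C4Pivotable G →
            sumSeq d + 4 ≡ 4 * n × d (fromℕ n) ≥ 2
necessity n d G realizes pivotable@(edges , _) =
  degreeSum (trans (sum-tabulate d) (trans (sum-cong-≗ (sym ∘ realizes)) (handshake G))) edges ,
  subst (2 ≤_) (realizes (fromℕ n)) (C4Pivotable⇒deg≥2 G pivotable (fromℕ n))
  where
  degreeSum : ∀ {s m} → s ≡ m * 2 → m + 4 ≡ 2 * suc n → s + 4 ≡ 4 * n
  degreeSum {m = m} refl edges = +-cancelʳ-≡ 4 _ _ (trans (double m) (trans (cong (_* 2) edges) (double′ n)))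
    where
    double : ∀ m → m * 2 + 4 + 4 ≡ (m + 4) * 2
    double = solve-∀
    double′ : ∀ n → 2 * suc n * 2 ≡ 4 * n + 4
    double′ = solve-∀

-- The two-tree construction

pattern outer i = suc (suc (suc (suc i)))

record DescendingMap (k : ℕ) : Set where
  field
    target          : Fin k → Fin (4 + k)
    rank            : Fin (4 + k) → ℕ
    rank-injective  : Injective _≡_ _≡_ rank
    rank-0<1        : rank 0F < rank 1F
    rank-1<2        : rank 1F < rank 2F
    rank-2<3        : rank 2F < rank 3F
    target-descends : ∀ i → rank (target i) < rank (outer i)

data Side : Set where
  first second : Side

_≟ˢ_ : (s s′ : Side) → Dec (s ≡ s′)
first  ≟ˢ first  = yes refl
first  ≟ˢ second = no λ ()
second ≟ˢ first  = no λ ()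
second ≟ˢ second = yes refl

sameSide : ∀ {s s′} → does (s ≟ˢ s′) ≡ true → s ≡ s′
sameSide {first}  {first}  _ = refl
sameSide {second} {second} _ = refl

-- Vertices 0F–3F form the central cycle, with edge j joining j and j + 1 mod 4. Each side
-- also joins every outer i to that side's target, and each side gives one spanning tree.
module Attachment {k : ℕ} (D : Side → DescendingMap k) where
  open DescendingMap using (target; target-descends)

  attachEdge : Side → Fin k → Fin (k + k)
  attachEdge first  i = i ↑ˡ k
  attachEdge second i = k ↑ʳ i

  side : Fin (k + k) → Side
  side e = [ (λ _ → first) , (λ _ → second) ]′ (splitAt k e)

  index : Fin (k + k) → Fin k
  index e = [ id , id ]′ (splitAt k e)

  side-attachEdge : ∀ s i → side (attachEdge s i) ≡ s
  side-attachEdge first  i = cong [ _ , _ ]′ (splitAt-↑ˡ k i k)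
  side-attachEdge second i = cong [ _ , _ ]′ (splitAt-↑ʳ k k i)

  index-attachEdge : ∀ s i → index (attachEdge s i) ≡ i
  index-attachEdge first  i = cong [ id , id ]′ (splitAt-↑ˡ k i k)
  index-attachEdge second i = cong [ id , id ]′ (splitAt-↑ʳ k k i)

  attachEdge-side-index : ∀ e → attachEdge (side e) (index e) ≡ e
  attachEdge-side-index e with splitAt k e in eq
  ... | inj₁ i = trans (cong (Fin.join k k) (sym eq)) (join-splitAt k k e)
  ... | inj₂ i = trans (cong (Fin.join k k) (sym eq)) (join-splitAt k k e)

  attachEdge-index : ∀ {s e} → side e ≡ s → attachEdge s (index e) ≡ e
  attachEdge-index {e = e} refl = attachEdge-side-index e

  edgeEnds : Fin (4 + (k + k)) → Fin (4 + k) × Fin (4 + k)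
  edgeEnds 0F        = 0F , 1F
  edgeEnds 1F        = 1F , 2F
  edgeEnds 2F        = 2F , 3F
  edgeEnds 3F        = 3F , 0F
  edgeEnds (outer e) = outer (index e) , target (D (side e)) (index e)

  G : Multigraph (4 + k)
  G = record { m = 4 + (k + k) ; ends = edgeEnds ; loopless = loopless′ }
    where
    loopless′ : ∀ e → proj₁ (edgeEnds e) ≢ proj₂ (edgeEnds e)
    loopless′ (outer e) same = <-irrefl (cong (DescendingMap.rank (D (side e))) (sym same)) (target-descends (D (side e)) (index e))

  inTree : Side → Fin (m G) → Bool
  inTree _      0F        = true
  inTree _      1F        = true
  inTree first  2F        = true
  inTree second 2F        = false
  inTree first  3F        = false
  inTree second 3F        = true
  inTree s      (outer e) = does (side e ≟ˢ s)

  tree : Side → Subset (m G)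
  tree s = tabulate (inTree s)

  parent : Side → Fin (4 + k) → Fin (m G)
  parent _      0F        = 0F
  parent _      1F        = 0F
  parent _      2F        = 1F
  parent first  3F        = 2F
  parent second 3F        = 3F
  parent s      (outer i) = outer (attachEdge s i)

  up : Side → Fin (4 + k) → Fin (4 + k)
  up _      0F        = 0F
  up _      1F        = 0F
  up _      2F        = 1F
  up first  3F        = 2F
  up second 3F        = 0F
  up s      (outer i) = target (D s) i

  attachEdge-ends : ∀ s i → edgeEnds (outer (attachEdge s i)) ≡ (outer i , target (D s) i)
  attachEdge-ends s i rewrite side-attachEdge s i | index-attachEdge s i = refl

  parent∈tree : ∀ s v → inTree s (parent s v) ≡ true
  parent∈tree _      0F        = refl
  parent∈tree _      1F        = refl
  parent∈tree _      2F        = refl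
  parent∈tree first  3F        = refl
  parent∈tree second 3F        = refl
  parent∈tree first  (outer i) rewrite side-attachEdge first i  = refl
  parent∈tree second (outer i) rewrite side-attachEdge second i = refl

  parent-joins : ∀ s v → v ≢ 0F → Joins G (parent s v) v (up s v)
  parent-joins _      0F        0≢0 = ⊥-elim (0≢0 refl)
  parent-joins _      1F        _   = inj₂ refl
  parent-joins _      2F        _   = inj₂ refl
  parent-joins first  3F        _   = inj₂ refl
  parent-joins second 3F        _   = inj₁ refl
  parent-joins first  (outer i) _   = inj₁ (attachEdge-ends first i)
  parent-joins second (outer i) _   = inj₁ (attachEdge-ends second i)

  up-lower : ∀ s v → v ≢ 0F → DescendingMap.rank (D s) (up s v) < DescendingMap.rank (D s) v
  up-lower s      0F        0≢0 = ⊥-elim (0≢0 refl)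
  up-lower s      1F        _   = DescendingMap.rank-0<1 (D s)
  up-lower s      2F        _   = DescendingMap.rank-1<2 (D s)
  up-lower first  3F        _   = DescendingMap.rank-2<3 (D first)
  up-lower second 3F        _   = <-trans rank-0<1 (<-trans rank-1<2 rank-2<3)
    where open DescendingMap (D second)
  up-lower first  (outer i) _   = target-descends (D first) i
  up-lower second (outer i) _   = target-descends (D second) i

  tree⊆parents : ∀ s e → inTree s e ≡ true → Σ[ v ∈ Fin (4 + k) ] v ≢ 0F × parent s v ≡ e
  tree⊆parents _      0F        _ = 1F , (λ ()) , refl
  tree⊆parents _      1F        _ = 2F , (λ ()) , refl
  tree⊆parents first  2F        _ = 3F , (λ ()) , refl
  tree⊆parents second 3F        _ = 3F , (λ ()) , refl
  tree⊆parents first  (outer e) e∈T = outer (index e) , (λ ()) , cong outer (attachEdge-index (sameSide e∈T))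
  tree⊆parents second (outer e) e∈T = outer (index e) , (λ ()) , cong outer (attachEdge-index (sameSide e∈T))

  parentEdges : ∀ s → ParentEdges G (tree s)
  parentEdges s = record
    { rank           = DescendingMap.rank (D s)
    ; rank-injective = DescendingMap.rank-injective (D s)
    ; root           = 0F
    ; parent         = parent s
    ; up             = up s
    ; parent∈T       = λ v _ → ∈-tabulate⁺ (inTree s) (parent∈tree s v)
    ; parent-joins   = parent-joins s
    ; up-lower       = up-lower s
    ; T⊆parents      = λ e e∈T → tree⊆parents s e (∈-tabulate⁻ (inTree s) e∈T)
    }

  cycle : Fin 4 → Fin (4 + k)
  cycle j = j ↑ˡ k

  mult-cycle : ∀ a b → mult G (cycle a) (cycle b) ≡ ∑[ j < 4 ] χ (joins? G (j ↑ˡ (k + k)) (cycle a) (cycle b)) + 0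
  mult-cycle a b = trans (count-tabulate (λ e → joins? G e (cycle a) (cycle b)) id)
    (trans (∑-splitAt 4 (k + k) (λ e → χ (joins? G e (cycle a) (cycle b))))
           (cong₂ _+_ refl (∑-zero {k + k} _ (λ e → χ-no (joins? G (outer e) (cycle a) (cycle b)) (outer-not-cycle e)))))
    where
    outer≢cycle : ∀ {i} j → outer i ≢ cycle j
    outer≢cycle 0F ()
    outer≢cycle 1F ()
    outer≢cycle 2F ()
    outer≢cycle 3F ()
    outer-not-cycle : ∀ e → ¬ Joins G (outer e) (cycle a) (cycle b)
    outer-not-cycle e (inj₁ ends≡) = outer≢cycle a (cong proj₁ ends≡)
    outer-not-cycle e (inj₂ ends≡) = outer≢cycle b (cong proj₁ ends≡)

  cycle-induced : InducedC4 G cycle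
  cycle-induced = ↑ˡ-injective k _ _ , consecutive , mult-cycle 0F 2F , mult-cycle 1F 3F
    where
    consecutive : ∀ j → mult G (cycle j) (cycle (c-next G j)) ≡ 1
    consecutive 0F = mult-cycle 0F 1F
    consecutive 1F = mult-cycle 1F 2F
    consecutive 2F = mult-cycle 2F 3F
    consecutive 3F = mult-cycle 3F 0F

  trees-share-two : ∣ tree first ∩ tree second ∣ ≡ 2
  trees-share-two = cong (2 +_) (∣tabulate∩tabulate∣≡0 (inTree first ∘ outer) (inTree second ∘ outer) disjoint)
    where
    disjoint : ∀ e → inTree first (outer e) ∧ inTree second (outer e) ≡ false
    disjoint e with side e
    ... | first  = refl
    ... | second = refl

  shared⇒cycle : ∀ e → e ∈ tree first ∩ tree second → OnCycle G cycle e
  shared⇒cycle e e∈∩ = on-cycle e (∈-tabulate⁻ (inTree first) e∈T₁) (∈-tabulate⁻ (inTree second) e∈T₂)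
    where
    e∈T₁ = proj₁ (x∈p∩q⁻ (tree first) (tree second) e∈∩)
    e∈T₂ = proj₂ (x∈p∩q⁻ (tree first) (tree second) e∈∩)
    on-cycle : ∀ e → inTree first e ≡ true → inTree second e ≡ true → OnCycle G cycle e
    on-cycle 0F        _  _  = 0F , inj₁ refl
    on-cycle 1F        _  _  = 1F , inj₁ refl
    on-cycle (outer e) e₁ e₂ with trans (sym (sameSide {side e} e₁)) (sameSide {side e} e₂)
    ... | ()

  deg-attachment : ∀ w → deg G w ≡ 2 + (fibreSize (target (D first)) w + fibreSize (target (D second)) w)
  deg-attachment w = begin
    deg G w
      ≡⟨ deg-endpoints G w ⟩
    (a 0F + a 1F) + ((a 1F + a 2F) + ((a 2F + a 3F) + ((a 3F + a 0F) + ∑[ e < k + k ] attachTerm e)))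
      ≡⟨ cong (λ t → (a 0F + a 1F) + ((a 1F + a 2F) + ((a 2F + a 3F) + ((a 3F + a 0F) + t)))) attachSum ⟩
    (a 0F + a 1F) + ((a 1F + a 2F) + ((a 2F + a 3F) + ((a 3F + a 0F) + ((O + F first) + (O + F second)))))
      ≡⟨ regroup (a 0F) (a 1F) (a 2F) (a 3F) O (F first) (F second) ⟩
    (a 0F + (a 1F + (a 2F + (a 3F + O)))) * 2 + (F first + F second)
      ≡⟨ cong (λ t → t * 2 + (F first + F second)) (∑-χ-≟ w) ⟩
    2 + (F first + F second) ∎
    where
    open ≡-Reasoning
    a : Fin 4 → ℕ
    a j = χ (cycle j ≟ w)
    O = ∑[ i < k ] χ (outer i ≟ w)
    F : Side → ℕ
    F s = fibreSize (target (D s)) w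
    attachTerm : Fin (k + k) → ℕ
    attachTerm e = χ (proj₁ (edgeEnds (outer e)) ≟ w) + χ (proj₂ (edgeEnds (outer e)) ≟ w)
    attachSide : ∀ s → ∑[ i < k ] attachTerm (attachEdge s i) ≡ O + F s
    attachSide s = trans (sum-cong-≗ (λ i → cong (λ (u , v) → χ (u ≟ w) + χ (v ≟ w)) (attachEdge-ends s i)))
                         (∑-distrib-+ {k} _ _)
    attachSum : ∑[ e < k + k ] attachTerm e ≡ (O + F first) + (O + F second)
    attachSum = trans (∑-splitAt k k attachTerm) (cong₂ _+_ (attachSide first) (attachSide second))
    regroup : ∀ a₀ a₁ a₂ a₃ o f g →
      (a₀ + a₁) + ((a₁ + a₂) + ((a₂ + a₃) + ((a₃ + a₀) + ((o + f) + (o + g))))) ≡ (a₀ + (a₁ + (a₂ + (a₃ + o)))) * 2 + (f + g)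
    regroup = solve-∀

  C4Pivotable-realization : ∀ {d} → (∀ w → 2 + (fibreSize (target (D first)) w + fibreSize (target (D second)) w) ≡ d w) →
                            Σ (Multigraph (4 + k)) λ G → Realizes G d × C4Pivotable G
  C4Pivotable-realization degrees =
    G , (λ w → trans (deg-attachment w) (degrees w)) ,
    edgeCount k , cycle , cycle-induced , tree first , tree second ,
    ParentEdges⇒SpanningTree G (parentEdges first) , ParentEdges⇒SpanningTree G (parentEdges second) ,
    trees-share-two , shared⇒cycle
    where
    edgeCount : ∀ k → 4 + (k + k) + 4 ≡ 2 * (4 + k)
    edgeCount = solve-∀

toℕ-descending : ∀ {k} (t : Fin k → Fin (4 + k)) → (∀ i → toℕ (t i) < 4 + toℕ i) → DescendingMap k
toℕ-descending t t<i = record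
  { target          = t
  ; rank            = toℕ
  ; rank-injective  = toℕ-injective
  ; rank-0<1        = s≤s z≤n
  ; rank-1<2        = s≤s (s≤s z≤n)
  ; rank-2<3        = s≤s (s≤s (s≤s z≤n))
  ; target-descends = t<i
  }

reverseOuter : ∀ {k} → Fin (4 + k) → Fin (4 + k)
reverseOuter 0F        = 0F
reverseOuter 1F        = 1F
reverseOuter 2F        = 2F
reverseOuter 3F        = 3F
reverseOuter (outer i) = outer (opposite i)

reverseOuter-involutive : ∀ {k} (v : Fin (4 + k)) → reverseOuter (reverseOuter v) ≡ v
reverseOuter-involutive 0F        = refl
reverseOuter-involutive 1F        = refl
reverseOuter-involutive 2F        = refl
reverseOuter-involutive 3F        = refl
reverseOuter-involutive (outer i) = cong outer (opposite-involutive i)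

-- Outer i is joined to outer (i + 1), and the last outer vertex to 0F. These edges go down
-- when the outer vertices are ranked in reverse order.
chain : ∀ {k} → Fin k → Fin (4 + k)
chain {suc k} i with view i
... | ‵fromℕ     = 0F
... | ‵inject₁ j = outer (suc j)

chain-fromℕ : ∀ k → chain (fromℕ k) ≡ 0F
chain-fromℕ k rewrite view-fromℕ k = refl

chain-inject₁ : ∀ {k} (j : Fin k) → chain (inject₁ j) ≡ outer (suc j)
chain-inject₁ j rewrite view-inject₁ j = refl

chainMap : ∀ {k} → DescendingMap k
chainMap = record
  { target          = chain
  ; rank            = toℕ ∘ reverseOuter
  ; rank-injective  = λ {u} {v} eq → trans (sym (reverseOuter-involutive u))
                        (trans (cong reverseOuter (toℕ-injective eq)) (reverseOuter-involutive v))
  ; rank-0<1        = s≤s z≤n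
  ; rank-1<2        = s≤s (s≤s z≤n)
  ; rank-2<3        = s≤s (s≤s (s≤s z≤n))
  ; target-descends = descends
  }
  where
  descends : ∀ {k} (i : Fin k) → toℕ (reverseOuter (chain i)) < toℕ (reverseOuter (outer i))
  descends {suc k} i with view i
  ... | ‵fromℕ     = s≤s z≤n
  ... | ‵inject₁ j = +-monoʳ-< 4 (begin-strict
    toℕ (opposite (suc j))       ≡⟨ opposite-prop (suc j) ⟩
    k ∸ suc (toℕ j)              <⟨ ∸-monoʳ-< (n<1+n (toℕ j)) (toℕ<n j) ⟩
    k ∸ toℕ j                    ≡⟨ cong (k ∸_) (toℕ-inject₁ j) ⟨
    k ∸ toℕ (inject₁ j)          ≡⟨ opposite-prop (inject₁ j) ⟨
    toℕ (opposite (inject₁ j))   ∎)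
    where open ≤-Reasoning

chainDemand : ℕ → ℕ
chainDemand 0                                 = 1
chainDemand 1                                 = 0
chainDemand 2                                 = 0
chainDemand 3                                 = 0
chainDemand 4                                 = 0
chainDemand (suc (suc (suc (suc (suc _))))) = 1

chainDemand≤1 : ∀ j → chainDemand j ≤ 1
chainDemand≤1 0                                 = ≤-refl
chainDemand≤1 1                                 = z≤n
chainDemand≤1 2                                 = z≤n
chainDemand≤1 3                                 = z≤n
chainDemand≤1 4                                 = z≤n
chainDemand≤1 (suc (suc (suc (suc (suc _))))) = ≤-refl

partialSum-chainDemand : ∀ {i} → 1 ≤ i → partialSum chainDemand (4 + i) ≡ i
partialSum-chainDemand {suc i} _ = cong suc (trans (∑-const i 1) (*-identityʳ i))

chain-fibre : ∀ {k} → 1 ≤ k → ∀ w → fibreSize (chain {k}) w ≡ chainDemand (toℕ w)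
chain-fibre {suc k} _ w = begin
  fibreSize chain w
    ≡⟨ sum-init-last (λ i → χ (chain i ≟ w)) ⟩
  ∑[ j < k ] χ (chain (inject₁ j) ≟ w) + χ (chain (fromℕ k) ≟ w)
    ≡⟨ cong₂ _+_ (sum-cong-≗ (λ j → cong (λ v → χ (v ≟ w)) (chain-inject₁ j))) (cong (λ v → χ (v ≟ w)) (chain-fromℕ k)) ⟩
  ∑[ j < k ] χ (outer (suc j) ≟ w) + χ (0F ≟ w)
    ≡⟨ by-vertex w ⟩
  chainDemand (toℕ w) ∎
  where
  open ≡-Reasoning
  by-vertex : ∀ w → ∑[ j < k ] χ (outer (suc j) ≟ w) + χ (0F ≟ w) ≡ chainDemand (toℕ w)
  by-vertex 0F                = cong (_+ 1) (∑-zero {k} _ (λ _ → refl))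
  by-vertex 1F                = cong (_+ 0) (∑-zero {k} _ (λ _ → refl))
  by-vertex 2F                = cong (_+ 0) (∑-zero {k} _ (λ _ → refl))
  by-vertex 3F                = cong (_+ 0) (∑-zero {k} _ (λ _ → refl))
  by-vertex (outer 0F)        = cong (_+ 0) (∑-zero {k} _ (λ _ → refl))
  by-vertex (outer (suc w))   = cong (_+ 0) (∑-χ-≟ w)

-- Sufficiency

module Sufficiency (k : ℕ) (d : Fin (4 + k) → ℕ) (d-noninc : NonIncreasing d)
                   (d-sum : sumSeq d + 4 ≡ 4 * (3 + k)) (d-last : 2 ≤ d (fromℕ (3 + k))) where

  excess : Fin (4 + k) → ℕ
  excess w = d w ∸ 2

  -- The excesses d − 2 as a sequence on ℕ, which is zero past the last vertex.
  x : ℕ → ℕ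
  x = extend excess

  2+excess : ∀ w → 2 + excess w ≡ d w
  2+excess w = m+[n∸m]≡n (≤-trans d-last (last≤ d-noninc w))

  x-toℕ : ∀ w → 2 + x (toℕ w) ≡ d w
  x-toℕ w = trans (cong (2 +_) (extend-toℕ excess w)) (2+excess w)

  x-antitone : AntitoneBelow (4 + k) x
  x-antitone = extend-antitone excess (λ i j i≤j → ∸-monoˡ-≤ 2 (d-noninc i j i≤j))

  x-sum : partialSum x (4 + k) ≡ 2 * k
  x-sum = +-cancelˡ-≡ (8 + 2 * k + 4) _ _ (begin
    8 + 2 * k + 4 + partialSum x (4 + k)         ≡⟨ cong (8 + 2 * k + 4 +_) (sum≡partialSum-extend excess) ⟨
    8 + 2 * k + 4 + ∑[ w < 4 + k ] excess w      ≡⟨ regroup k (∑[ w < 4 + k ] excess w) ⟩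
    (4 + k) * 2 + ∑[ w < 4 + k ] excess w + 4    ≡⟨ cong (λ t → t + ∑[ w < 4 + k ] excess w + 4) (∑-const (4 + k) 2) ⟨
    ∑[ w < 4 + k ] 2 + ∑[ w < 4 + k ] excess w + 4 ≡⟨ cong (_+ 4) (∑-distrib-+ {4 + k} (λ _ → 2) excess) ⟨
    ∑[ w < 4 + k ] (2 + excess w) + 4            ≡⟨ cong (_+ 4) (trans (sum-cong-≗ 2+excess) (sym (sum-tabulate d))) ⟩
    sumSeq d + 4                                 ≡⟨ d-sum ⟩
    4 * (3 + k)                                  ≡⟨ regroup′ k ⟩
    8 + 2 * k + 4 + 2 * k                        ∎)
    where
    open ≡-Reasoning
    regroup : ∀ k s → 8 + 2 * k + 4 + s ≡ (4 + k) * 2 + s + 4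
    regroup = solve-∀
    regroup′ : ∀ k → 4 * (3 + k) ≡ 8 + 2 * k + 4 + 2 * k
    regroup′ = solve-∀

  lastExcess : ℕ
  lastExcess = x (3 + k)

  lastExcess≤1 : lastExcess ≤ 1
  lastExcess≤1 = ≮⇒≥ λ 1<lastExcess → <⇒≱ (subst (2 * k <_) (*-comm 2 (4 + k)) (*-monoʳ-< 2 (m<n+m k {4} z<s))) (begin
    (4 + k) * 2              ≤⟨ partialSum-lower 2 (4 + k) (λ j j<N → ≤-trans 1<lastExcess (x-antitone (s≤s⁻¹ j<N) ≤-refl)) ⟩
    partialSum x (4 + k)     ≡⟨ x-sum ⟩
    2 * k                    ∎)
    where open ≤-Reasoning

  -- Either x (4 + i) ≥ 3 and the prefix alone is big enough, or the k − i terms from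
  -- 4 + i onward contribute at most 2 each, apart from the last.
  prefix-bound : ∀ {i} → i < k → 2 + 2 * i ≤ partialSum x (4 + i) + lastExcess
  prefix-bound {i} i<k with 3 ≤? x (4 + i)
  ... | yes 3≤x = begin
    2 + 2 * i                           ≤⟨ m≤n+m (2 + 2 * i) (i + 10) ⟩
    i + 10 + (2 + 2 * i)                ≡⟨ spread i ⟩
    (4 + i) * 3                         ≤⟨ partialSum-lower 3 (4 + i) (λ j j<p → ≤-trans 3≤x (x-antitone (<⇒≤ j<p) p<N)) ⟩
    partialSum x (4 + i)                ≤⟨ m≤m+n _ lastExcess ⟩
    partialSum x (4 + i) + lastExcess   ∎
    where
    open ≤-Reasoning
    p<N = +-monoʳ-< 4 i<k
    spread : ∀ i → i + 10 + (2 + 2 * i) ≡ (4 + i) * 3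
    spread = solve-∀
  ... | no 3≰x = +-cancelʳ-≤ (q * 2) _ _ (begin
    2 + 2 * i + q * 2                                       ≡⟨ trans (double i q) (cong (2 *_) k≡) ⟩
    2 * k                                                   ≡⟨ x-sum ⟨
    partialSum x (4 + k)                                    ≡⟨ cong (partialSum x) N≡ ⟩
    partialSum x (4 + i + suc q)                            ≤⟨ partialSum-tail-bound (4 + i) q antitone (s≤s⁻¹ (≰⇒> 3≰x)) ⟩
    partialSum x (4 + i) + (q * 2 + x (4 + i + q))          ≡⟨ cong (λ t → partialSum x (4 + i) + (q * 2 + x t)) last≡ ⟩
    partialSum x (4 + i) + (q * 2 + lastExcess)             ≡⟨ swap (partialSum x (4 + i)) (q * 2) lastExcess ⟩
    partialSum x (4 + i) + lastExcess + q * 2               ∎)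
    where
    open ≤-Reasoning
    q = k ∸ suc i
    k≡ : suc i + q ≡ k
    k≡ = m+[n∸m]≡n i<k
    double : ∀ i q → 2 + 2 * i + q * 2 ≡ 2 * (suc i + q)
    double = solve-∀
    shift : ∀ i q → 4 + (suc i + q) ≡ 4 + i + suc q
    shift = solve-∀
    shift′ : ∀ i q → 4 + i + q ≡ 3 + (suc i + q)
    shift′ = solve-∀
    swap : ∀ a b c → a + (b + c) ≡ a + c + b
    swap = solve-∀
    N≡ : 4 + k ≡ 4 + i + suc q
    N≡ = trans (cong (4 +_) (sym k≡)) (shift i q)
    last≡ : 4 + i + q ≡ 3 + k
    last≡ = trans (shift′ i q) (cong (3 +_) k≡)
    antitone : AntitoneBelow (4 + i + suc q) x
    antitone = subst (λ N → AntitoneBelow N x) N≡ x-antitone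

  module _ (lastExcess≡0 : lastExcess ≡ 0) where

    pairs-fit : ∀ (i : Fin k) → 2 + 2 * toℕ i ≤ partialSum x (4 + toℕ i)
    pairs-fit i = subst (2 + 2 * toℕ i ≤_) (trans (cong (partialSum x (4 + toℕ i) +_) lastExcess≡0) (+-identityʳ _))
                        (prefix-bound (toℕ<n i))

    pairedSlot : Side → Fin k → Fin (4 + k)
    pairedSlot first  i = slot (3 + k) x (2 * toℕ i)
    pairedSlot second i = slot (3 + k) x (suc (2 * toℕ i))

    pairedMap : Side → DescendingMap k
    pairedMap first  = toℕ-descending (pairedSlot first)  (λ i → slot-bound (3 + k) x (4 + toℕ i) (<-trans (n<1+n _) (pairs-fit i)))
    pairedMap second = toℕ-descending (pairedSlot second) (λ i → slot-bound (3 + k) x (4 + toℕ i) (pairs-fit i))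

    paired-degrees : ∀ w → 2 + (fibreSize (pairedSlot first) w + fibreSize (pairedSlot second) w) ≡ d w
    paired-degrees w = begin
      2 + (fibreSize (pairedSlot first) w + fibreSize (pairedSlot second) w)
        ≡⟨ cong (2 +_) (∑-distrib-+ {k} _ _) ⟨
      2 + ∑[ i < k ] (hit (2 * toℕ i) + hit (suc (2 * toℕ i)))
        ≡⟨⟩
      2 + partialSum (λ t → hit (2 * t) + hit (suc (2 * t))) k
        ≡⟨ cong (2 +_) (partialSum-pairs hit k) ⟩
      2 + partialSum hit (2 * k)
        ≡⟨ cong (λ s → 2 + partialSum hit s) x-sum ⟨
      2 + partialSum hit (partialSum x (4 + k))
        ≡⟨ cong (2 +_) (slot-fibre (3 + k) x w) ⟩
      2 + x (toℕ w)
        ≡⟨ x-toℕ w ⟩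
      d w ∎
      where
      open ≡-Reasoning
      hit : ℕ → ℕ
      hit j = χ (slot (3 + k) x j ≟ w)

  -- Now every excess is ≥ 1, so the last vertex must be a target. An index-ranked side
  -- cannot make it one, so the second side is the chain.
  module _ (lastExcess≡1 : lastExcess ≡ 1) where

    x≥1 : ∀ {j} → j < 4 + k → 1 ≤ x j
    x≥1 j<N = ≤-trans (≤-reflexive (sym lastExcess≡1)) (x-antitone (s≤s⁻¹ j<N) ≤-refl)

    k≥1 : 1 ≤ k
    k≥1 = n≢0⇒n>0 λ k≡0 → <⇒≱ (x≥1 {0} (s≤s z≤n)) (begin
      x 0                    ≤⟨ m≤m+n (x 0) _ ⟩
      partialSum x (4 + k)   ≡⟨ x-sum ⟩
      2 * k                  ≡⟨ cong (2 *_) k≡0 ⟩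
      0                      ∎)
      where open ≤-Reasoning

    a : ℕ → ℕ
    a j = x j ∸ chainDemand j

    a+chainDemand : ∀ {j} → j < 4 + k → a j + chainDemand j ≡ x j
    a+chainDemand {j} j<N = m∸n+n≡m (≤-trans (chainDemand≤1 j) (x≥1 j<N))

    partialSum-a+chainDemand : ∀ {p} → p ≤ 4 + k → partialSum a p + partialSum chainDemand p ≡ partialSum x p
    partialSum-a+chainDemand {p} p≤N = trans (sym (∑-distrib-+ {p} (a ∘ toℕ) (chainDemand ∘ toℕ)))
                                             (partialSum-cong p (λ j j<p → a+chainDemand (<-≤-trans j<p p≤N)))

    a-sum : partialSum a (4 + k) ≡ k
    a-sum = +-cancelʳ-≡ k _ _ (begin
      partialSum a (4 + k) + k                                    ≡⟨ cong (partialSum a (4 + k) +_) (partialSum-chainDemand k≥1) ⟨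
      partialSum a (4 + k) + partialSum chainDemand (4 + k)       ≡⟨ partialSum-a+chainDemand ≤-refl ⟩
      partialSum x (4 + k)                                        ≡⟨ x-sum ⟩
      2 * k                                                       ≡⟨ cong (k +_) (+-identityʳ k) ⟩
      k + k                                                       ∎)
      where open ≡-Reasoning

    a-prefix : ∀ {i} → i < k → suc i ≤ partialSum a (4 + i)
    a-prefix {zero}  _   = +-cancelʳ-≤ 1 1 _ (begin
      2                                         ≤⟨ s≤s (s≤s z≤n) ⟩
      4 * 1                                     ≤⟨ partialSum-lower 1 4 (λ j j<4 → x≥1 (≤-trans j<4 (m≤m+n 4 k))) ⟩
      partialSum x 4                            ≡⟨ partialSum-a+chainDemand (m≤m+n 4 k) ⟨
      partialSum a 4 + 1                        ∎)
      where open ≤-Reasoning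
    a-prefix {suc i} i<k = +-cancelʳ-≤ (suc i + 1) _ _ (begin
      suc (suc i) + (suc i + 1)                 ≡⟨ regroup i ⟩
      2 + 2 * suc i                             ≤⟨ prefix-bound i<k ⟩
      partialSum x (4 + suc i) + lastExcess              ≡⟨ cong₂ _+_ (partialSum-a+chainDemand (<⇒≤ (+-monoʳ-< 4 i<k))) (sym lastExcess≡1) ⟨
      partialSum a (5 + i) + partialSum chainDemand (4 + suc i) + 1
                                                ≡⟨ cong (λ t → partialSum a (5 + i) + t + 1) (partialSum-chainDemand (s≤s z≤n)) ⟩
      partialSum a (5 + i) + suc i + 1          ≡⟨ +-assoc (partialSum a (5 + i)) (suc i) 1 ⟩
      partialSum a (5 + i) + (suc i + 1)        ∎)
      where
      open ≤-Reasoning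
      regroup : ∀ i → suc (suc i) + (suc i + 1) ≡ 2 + 2 * suc i
      regroup = solve-∀

    chainedSlot : Fin k → Fin (4 + k)
    chainedSlot i = slot (3 + k) a (toℕ i)

    chainedMap : Side → DescendingMap k
    chainedMap first  = toℕ-descending chainedSlot (λ i → slot-bound (3 + k) a (4 + toℕ i) (a-prefix (toℕ<n i)))
    chainedMap second = chainMap

    chained-degrees : ∀ w → 2 + (fibreSize chainedSlot w + fibreSize chain w) ≡ d w
    chained-degrees w = begin
      2 + (fibreSize chainedSlot w + fibreSize chain w)
        ≡⟨⟩
      2 + (partialSum hit k + fibreSize chain w)
        ≡⟨ cong (λ s → 2 + (partialSum hit s + fibreSize chain w)) a-sum ⟨
      2 + (partialSum hit (partialSum a (4 + k)) + fibreSize chain w)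
        ≡⟨ cong₂ (λ s t → 2 + (s + t)) (slot-fibre (3 + k) a w) (chain-fibre k≥1 w) ⟩
      2 + (a (toℕ w) + chainDemand (toℕ w))
        ≡⟨ cong (2 +_) (a+chainDemand (toℕ<n w)) ⟩
      2 + x (toℕ w)
        ≡⟨ x-toℕ w ⟩
      d w ∎
      where
      open ≡-Reasoning
      hit : ℕ → ℕ
      hit j = χ (slot (3 + k) a j ≟ w)

  realization : Σ (Multigraph (4 + k)) λ G → Realizes G d × C4Pivotable G
  realization with m≤n⇒m<n∨m≡n lastExcess≤1
  ... | inj₁ lastExcess<1 = Attachment.C4Pivotable-realization (pairedMap lastExcess≡0) (paired-degrees lastExcess≡0)
    where lastExcess≡0 = n<1⇒n≡0 lastExcess<1
  ... | inj₂ lastExcess≡1 = Attachment.C4Pivotable-realization (chainedMap lastExcess≡1) (chained-degrees lastExcess≡1)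

enough-vertices : ∀ n (d : Fin (suc n) → ℕ) → NonIncreasing d → sumSeq d + 4 ≡ 4 * n → d (fromℕ n) ≥ 2 → 3 ≤ n
enough-vertices n d d-noninc d-sum d-last =
  *-cancelˡ-≤ 2 (+-cancelˡ-≤ (2 * n) _ _ (begin
    2 * n + 2 * 3                ≡⟨ regroup n ⟩
    suc n * 2 + 4                ≡⟨ cong (_+ 4) (∑-const (suc n) 2) ⟨
    ∑[ w < suc n ] 2 + 4         ≤⟨ +-monoˡ-≤ 4 (∑-mono-≤ (λ w → ≤-trans d-last (last≤ d-noninc w))) ⟩
    sum d + 4                    ≡⟨ cong (_+ 4) (sum-tabulate d) ⟨
    sumSeq d + 4                 ≡⟨ d-sum ⟩
    4 * n                        ≡⟨ regroup′ n ⟩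
    2 * n + 2 * n                ∎))
  where
  open ≤-Reasoning
  regroup : ∀ n → 2 * n + 2 * 3 ≡ suc n * 2 + 4
  regroup = solve-∀
  regroup′ : ∀ n → 4 * n ≡ 2 * n + 2 * n
  regroup′ = solve-∀

sufficiency : ∀ n (d : Fin (suc n) → ℕ) → NonIncreasing d → sumSeq d + 4 ≡ 4 * n × d (fromℕ n) ≥ 2 →
              Σ (Multigraph (suc n)) λ G → Realizes G d × C4Pivotable G
sufficiency n d d-noninc (d-sum , d-last) with enough-vertices n d d-noninc d-sum d-last
... | s≤s (s≤s (s≤s _)) = Sufficiency.realization _ d d-noninc d-sum d-last

theorem5p4 : (n : ℕ) (d : Fin (suc n) → ℕ) → NonIncreasing d → Multigraphical d →
    ((Σ (Multigraph (suc n)) λ G → Realizes G d × C4Pivotable G)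
      ⇔ (sumSeq d + 4 ≡ 4 * n × d (fromℕ n) ≥ 2))
theorem5p4 n d d-noninc _ =
  mk⇔ (λ (G , realizes , pivotable) → necessity n d G realizes pivotable) (sufficiency n d d-noninc)
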